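{- Let $n\ge1$. The map $T$ is a bijection from the set of properly-marked $\{L,R\}$-words of length $n-1$ to the set of subgraphs $(V,E)$ of the path graph $P_n$ with $n\in V$. Moreover, for each such word $w$, the number of marked $L$-elements of $w$ equals the number of edges of $T(w)$, and the number of connected components of $T(w)$ equals one plus the number of unmarked $L$-elements of $w$.
   Context: $P_n$ has vertex set $[n]$ and edges $\{i,i+1\}$, $i\in[n-1]$. A subgraph of $P_n$ is a pair $(V,E)$ with $V\subseteq[n]$ non-empty and $E$ a set of edges of $P_n$ with both endpoints in $V$. A properly-marked $\{L,R\}$-word is a word over the alphabet $\{L^u,L^m,R\}$ in which every occurrence of $L^m$ is either the last letter or is immediately followed by $L^u$ or $L^m$; occurrences of $L^m$ are the marked $L$-elements, occurrences of $L^u$ the unmarked $L$-elements. For such a word $w=w_1\cdots w_{n-1}$, $T(w)$ is the subgraph of $P_n$ with vertex set $\{i\in[n-1]: w_i\in\{L^u,L^m\}\}\cup\{n\}$ and edge set $\{\{i,i+1\}: w_i=L^m\}$. -}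

module Defs where

open import Data.Nat using (ℕ; zero; suc; _+_)
open import Data.Bool using (Bool; true; false)
open import Data.Fin using (Fin; fromℕ; inject₁) renaming (suc to fsuc)
open import Data.Vec using (Vec; []; _∷_; _∷ʳ_; map; lookup; count)
open import Data.Product using (Σ; _×_; ∃)
open import Data.Sum using (_⊎_)
open import Data.Unit using (⊤)
open import Data.Empty using (⊥)
open import Relation.Nullary using (yes; no)
open import Relation.Unary using (Decidable)
open import Relation.Binary.PropositionalEquality using (_≡_)
open import Relation.Binary.Construct.Closure.ReflexiveTransitive using (Star)
open import Function.Bundles using (_⇔_)

data Letter : Set where
  Lu Lm R : Letter

ProperlyMarked : ∀ {m} → Vec Letter m → Set
ProperlyMarked [] = ⊤
ProperlyMarked (Lm ∷ []) = ⊤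
ProperlyMarked (Lm ∷ R ∷ w) = ⊥
ProperlyMarked (Lm ∷ Lu ∷ w) = ProperlyMarked (Lu ∷ w)
ProperlyMarked (Lm ∷ Lm ∷ w) = ProperlyMarked (Lm ∷ w)
ProperlyMarked (Lu ∷ w) = ProperlyMarked w
ProperlyMarked (R ∷ w) = ProperlyMarked w

isL : Letter → Bool
isL Lu = true
isL Lm = true
isL R = false

isLm : Letter → Bool
isLm Lm = true
isLm _ = false

isLu : Letter → Bool
isLu Lu = true
isLu _ = false

isLm? : Decidable (λ x → isLm x ≡ true)
isLm? Lu = no (λ ())
isLm? Lm = yes Relation.Binary.PropositionalEquality.refl
isLm? R = no (λ ())

isLu? : Decidable (λ x → isLu x ≡ true)
isLu? Lu = yes Relation.Binary.PropositionalEquality.refl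
isLu? Lm = no (λ ())
isLu? R = no (λ ())

#marked : ∀ {m} → Vec Letter m → ℕ
#marked = count isLm?

#unmarked : ∀ {m} → Vec Letter m → ℕ
#unmarked = count isLu?

-- Vertices of P_(suc m) are Fin (suc m) (vertex k+1 of the paper is index k);
-- edge i : Fin m of P_(suc m) is {inject₁ i , fsuc i}.
GraphData : ℕ → Set
GraphData m = Vec Bool (suc m) × Vec Bool m

vset : ∀ {m} → GraphData m → Vec Bool (suc m)
vset = Data.Product.proj₁

eset : ∀ {m} → GraphData m → Vec Bool m
eset = Data.Product.proj₂

IsSubgraph : ∀ {m} → GraphData m → Set
IsSubgraph {m} G =
  (∃ λ (v : Fin (suc m)) → lookup (vset G) v ≡ true) ×
  (∀ (i : Fin m) → lookup (eset G) i ≡ true →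
     (lookup (vset G) (inject₁ i) ≡ true) × (lookup (vset G) (fsuc i) ≡ true))

ContainsLast : ∀ {m} → GraphData m → Set
ContainsLast {m} G = lookup (vset G) (fromℕ m) ≡ true

T : ∀ {m} → Vec Letter m → GraphData m
T w = (map isL w ∷ʳ true) Data.Product., map isLm w

#edges : ∀ {m} → GraphData m → ℕ
#edges G = count (λ b → b Data.Bool.≟ true) (eset G)

Adj : ∀ {m} → GraphData m → Fin (suc m) → Fin (suc m) → Set
Adj {m} G u v = ∃ λ (i : Fin m) → lookup (eset G) i ≡ true ×
  ((u ≡ inject₁ i × v ≡ fsuc i) ⊎ (u ≡ fsuc i × v ≡ inject₁ i))

Reach : ∀ {m} → GraphData m → Fin (suc m) → Fin (suc m) → Set
Reach G = Star (Adj G)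

HasComponents : ∀ {m} → GraphData m → ℕ → Set
HasComponents {m} G k =
  Σ (Fin (suc m) → Fin k) λ c →
    (∀ u v → lookup (vset G) u ≡ true → lookup (vset G) v ≡ true →
       (c u ≡ c v) ⇔ Reach G u v) ×
    (∀ (j : Fin k) → ∃ λ v → lookup (vset G) v ≡ true × c v ≡ j)

-- Position i of a word is a vertex of T w iff w_i is an L, and {i,i+1} is an
-- edge iff w_i is marked; being properly marked says exactly that every edge
-- ends in a vertex. So T is inverted letter by letter, reading off a letter
-- from the pair (vertex bit, edge bit). A component of T w is a run of vertices
-- joined by marked L's; it ends at an unmarked L or at n, so there are
-- 1 + #L^u components, and the edges are the marked L's.
{-# OPTIONS --safe #-}
module Submission where

open import Defs
open import Data.Nat using (ℕ; suc)
open import Data.Vec using (Vec)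
open import Data.Product using (_×_; ∃)
open import Relation.Binary.PropositionalEquality using (_≡_)

open import Data.Bool using (Bool; true; false)
open import Data.Fin using (Fin; fromℕ; inject₁) renaming (zero to fzero; suc to fsuc)
open import Data.Fin.Properties using (suc-injective)
open import Data.Vec using ([]; _∷_; lookup)
open import Data.Product using (_,_; proj₁; proj₂)
open import Data.Product.Properties using (×-≡,≡→≡)
open import Data.Sum using (inj₁; inj₂)
open import Data.Unit using (tt)
open import Function using (_∘_)
open import Function.Bundles using (mk⇔)
open import Relation.Binary.PropositionalEquality using (refl; sym; trans; cong; cong₂)
open import Relation.Binary.Construct.Closure.ReflexiveTransitive using (ε; _◅_; _◅◅_; gmap)

EdgesWithinVertices : ∀ {m} → Vec Bool (suc m) → Vec Bool m → Set
EdgesWithinVertices {m} v e =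
  ∀ (i : Fin m) → lookup e i ≡ true →
    (lookup v (inject₁ i) ≡ true) × (lookup v (fsuc i) ≡ true)

properlyMarked-Lm∷⁻ : ∀ {m} (w : Vec Letter m) → ProperlyMarked (Lm ∷ w) →
  ProperlyMarked w × lookup (vset (T w)) fzero ≡ true
properlyMarked-Lm∷⁻ []       _ = tt , refl
properlyMarked-Lm∷⁻ (Lu ∷ w) p = p , refl
properlyMarked-Lm∷⁻ (Lm ∷ w) p = p , refl
properlyMarked-Lm∷⁻ (R ∷ w)  ()

properlyMarked-Lm∷⁺ : ∀ {m} (w : Vec Letter m) → ProperlyMarked w →
  lookup (vset (T w)) fzero ≡ true → ProperlyMarked (Lm ∷ w)
properlyMarked-Lm∷⁺ []       _ _  = tt
properlyMarked-Lm∷⁺ (Lu ∷ w) p _  = p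
properlyMarked-Lm∷⁺ (Lm ∷ w) p _  = p
properlyMarked-Lm∷⁺ (R ∷ w)  _ ()

properlyMarked-tail : ∀ {m} x (w : Vec Letter m) → ProperlyMarked (x ∷ w) → ProperlyMarked w
properlyMarked-tail Lu w p = p
properlyMarked-tail Lm w p = proj₁ (properlyMarked-Lm∷⁻ w p)
properlyMarked-tail R  w p = p

T-containsLast : ∀ {m} (w : Vec Letter m) → ContainsLast (T w)
T-containsLast []      = refl
T-containsLast (x ∷ w) = T-containsLast w

T-edgesWithinVertices : ∀ {m} (w : Vec Letter m) → ProperlyMarked w →
  EdgesWithinVertices (vset (T w)) (eset (T w))
T-edgesWithinVertices (Lm ∷ w) p fzero    _  = refl , proj₂ (properlyMarked-Lm∷⁻ w p)
T-edgesWithinVertices (Lu ∷ w) p fzero    ()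
T-edgesWithinVertices (R ∷ w)  p fzero    ()
T-edgesWithinVertices (x ∷ w)  p (fsuc i) e  =
  T-edgesWithinVertices w (properlyMarked-tail x w p) i e

T-isSubgraph : ∀ {m} (w : Vec Letter m) → ProperlyMarked w → IsSubgraph (T w)
T-isSubgraph {m} w p = (fromℕ m , T-containsLast w) , T-edgesWithinVertices w p

letter : (vertex edge : Bool) → Letter
letter false _     = R
letter true  false = Lu
letter true  true  = Lm

letter-isL-isLm : ∀ x → letter (isL x) (isLm x) ≡ x
letter-isL-isLm Lu = refl
letter-isL-isLm Lm = refl
letter-isL-isLm R  = refl

isL-letter : ∀ b f → isL (letter b f) ≡ b
isL-letter false _     = refl
isL-letter true  false = refl
isL-letter true  true  = refl

isLm-letter : ∀ b f → (f ≡ true → b ≡ true) → isLm (letter b f) ≡ f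
isLm-letter false false _      = refl
isLm-letter true  false _      = refl
isLm-letter true  true  _      = refl
isLm-letter false true  b≡true = b≡true refl

decode : ∀ {m} → Vec Bool (suc m) → Vec Bool m → Vec Letter m
decode _       []      = []
decode (b ∷ v) (f ∷ e) = letter b f ∷ decode v e

T⁻¹ : ∀ {m} → GraphData m → Vec Letter m
T⁻¹ G = decode (vset G) (eset G)

T⁻¹-T : ∀ {m} (w : Vec Letter m) → T⁻¹ (T w) ≡ w
T⁻¹-T []      = refl
T⁻¹-T (x ∷ w) = cong₂ _∷_ (letter-isL-isLm x) (T⁻¹-T w)

T-injective : ∀ {m} (w w′ : Vec Letter m) → T w ≡ T w′ → w ≡ w′
T-injective w w′ eq = trans (sym (T⁻¹-T w)) (trans (cong T⁻¹ eq) (T⁻¹-T w′))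

vset-T-decode : ∀ {m} (v : Vec Bool (suc m)) (e : Vec Bool m) →
  lookup v (fromℕ m) ≡ true → vset (T (decode v e)) ≡ v
vset-T-decode (true ∷ []) []      _    = refl
vset-T-decode (b ∷ v)     (f ∷ e) last = cong₂ _∷_ (isL-letter b f) (vset-T-decode v e last)

eset-T-decode : ∀ {m} (v : Vec Bool (suc m)) (e : Vec Bool m) →
  EdgesWithinVertices v e → eset (T (decode v e)) ≡ e
eset-T-decode _       []      _       = refl
eset-T-decode (b ∷ v) (f ∷ e) inside =
  cong₂ _∷_ (isLm-letter b f (proj₁ ∘ inside fzero)) (eset-T-decode v e (inside ∘ fsuc))

T-T⁻¹ : ∀ {m} (G : GraphData m) → IsSubgraph G → ContainsLast G → T (T⁻¹ G) ≡ G
T-T⁻¹ (v , e) (_ , inside) last = ×-≡,≡→≡ (vset-T-decode v e last , eset-T-decode v e inside)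

first-vertex-T-decode : ∀ {m} (v : Vec Bool (suc m)) (e : Vec Bool m) →
  lookup v fzero ≡ true → lookup (vset (T (decode v e))) fzero ≡ true
first-vertex-T-decode _       []      _      = refl
first-vertex-T-decode (b ∷ v) (f ∷ e) b≡true = trans (isL-letter b f) b≡true

decode-properlyMarked : ∀ {m} (v : Vec Bool (suc m)) (e : Vec Bool m) →
  EdgesWithinVertices v e → ProperlyMarked (decode v e)
decode-properlyMarked _       []      _      = tt
decode-properlyMarked (b ∷ v) (f ∷ e) inside = go b f (inside fzero)
  where
  rest : ProperlyMarked (decode v e)
  rest = decode-properlyMarked v e (inside ∘ fsuc)

  go : ∀ b f → (f ≡ true → (b ≡ true) × (lookup v fzero ≡ true)) →
       ProperlyMarked (letter b f ∷ decode v e)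
  go false false _ = rest
  go true  false _ = rest
  go b     true  ends with ends refl
  ... | refl , next = properlyMarked-Lm∷⁺ (decode v e) rest (first-vertex-T-decode v e next)

T⁻¹-properlyMarked : ∀ {m} (G : GraphData m) → IsSubgraph G → ProperlyMarked (T⁻¹ G)
T⁻¹-properlyMarked (v , e) (_ , inside) = decode-properlyMarked v e inside

#marked≡#edges : ∀ {m} (w : Vec Letter m) → #marked w ≡ #edges (T w)
#marked≡#edges []       = refl
#marked≡#edges (Lu ∷ w) = #marked≡#edges w
#marked≡#edges (Lm ∷ w) = cong suc (#marked≡#edges w)
#marked≡#edges (R ∷ w)  = #marked≡#edges w

-- component w v is the number of unmarked L's before v; positions outside
-- T w (letters R) get the junk value 0.
component : ∀ {m} (w : Vec Letter m) → Fin (suc m) → Fin (suc (#unmarked w))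
component []       _        = fzero
component (Lu ∷ w) fzero    = fzero
component (Lu ∷ w) (fsuc v) = fsuc (component w v)
component (Lm ∷ w) fzero    = component w fzero
component (Lm ∷ w) (fsuc v) = component w v
component (R ∷ w)  fzero    = fzero
component (R ∷ w)  (fsuc v) = component w v

component-edge : ∀ {m} (w : Vec Letter m) (i : Fin m) → lookup (eset (T w)) i ≡ true →
  component w (inject₁ i) ≡ component w (fsuc i)
component-edge (Lm ∷ w) fzero    _  = refl
component-edge (Lu ∷ w) fzero    ()
component-edge (R ∷ w)  fzero    ()
component-edge (Lu ∷ w) (fsuc i) e  = cong fsuc (component-edge w i e)
component-edge (Lm ∷ w) (fsuc i) e  = component-edge w i e
component-edge (R ∷ w)  (fsuc i) e  = component-edge w i e

Reach⇒component≡ : ∀ {m} (w : Vec Letter m) {u v} → Reach (T w) u v →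
  component w u ≡ component w v
Reach⇒component≡ w ε = refl
Reach⇒component≡ w ((i , e , inj₁ (refl , refl)) ◅ r) =
  trans (component-edge w i e) (Reach⇒component≡ w r)
Reach⇒component≡ w ((i , e , inj₂ (refl , refl)) ◅ r) =
  trans (sym (component-edge w i e)) (Reach⇒component≡ w r)

Reach-∷ : ∀ {m} x (w : Vec Letter m) {u v} → Reach (T w) u v →
  Reach (T (x ∷ w)) (fsuc u) (fsuc v)
Reach-∷ x w = gmap fsuc shift
  where
  shift : ∀ {u v} → Adj (T w) u v → Adj (T (x ∷ w)) (fsuc u) (fsuc v)
  shift (i , e , inj₁ (p , q)) = fsuc i , e , inj₁ (cong fsuc p , cong fsuc q)
  shift (i , e , inj₂ (p , q)) = fsuc i , e , inj₂ (cong fsuc p , cong fsuc q)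

component≡⇒Reach : ∀ {m} (w : Vec Letter m) → ProperlyMarked w → ∀ u v →
  lookup (vset (T w)) u ≡ true → lookup (vset (T w)) v ≡ true →
  component w u ≡ component w v → Reach (T w) u v
component≡⇒Reach []       _ fzero    fzero    _  _  _  = ε
component≡⇒Reach (x ∷ w)  _ fzero    fzero    _  _  _  = ε
component≡⇒Reach (Lu ∷ w) _ fzero    (fsuc v) _  _  ()
component≡⇒Reach (Lu ∷ w) _ (fsuc u) fzero    _  _  ()
component≡⇒Reach (R ∷ w)  _ fzero    (fsuc v) () _  _
component≡⇒Reach (R ∷ w)  _ (fsuc u) fzero    _  () _
component≡⇒Reach (Lu ∷ w) p (fsuc u) (fsuc v) hu hv eq =
  Reach-∷ Lu w (component≡⇒Reach w p u v hu hv (suc-injective eq))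
component≡⇒Reach (R ∷ w)  p (fsuc u) (fsuc v) hu hv eq =
  Reach-∷ R w (component≡⇒Reach w p u v hu hv eq)
component≡⇒Reach (Lm ∷ w) p u v hu hv eq with properlyMarked-Lm∷⁻ w p
... | p′ , next with u | v
...   | fzero  | fzero  = ε
...   | fzero  | fsuc v = (fzero , refl , inj₁ (refl , refl))
                            ◅ Reach-∷ Lm w (component≡⇒Reach w p′ fzero v next hv eq)
...   | fsuc u | fzero  = Reach-∷ Lm w (component≡⇒Reach w p′ u fzero hu next eq)
                            ◅◅ ((fzero , refl , inj₂ (refl , refl)) ◅ ε)
...   | fsuc u | fsuc v = Reach-∷ Lm w (component≡⇒Reach w p′ u v hu hv eq)

component-surjective : ∀ {m} (w : Vec Letter m) (j : Fin (suc (#unmarked w))) →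
  ∃ λ v → lookup (vset (T w)) v ≡ true × component w v ≡ j
component-surjective []       fzero = fzero , refl , refl
component-surjective (Lu ∷ w) fzero = fzero , refl , refl
component-surjective (Lu ∷ w) (fsuc j) with component-surjective w j
... | v , hv , eq = fsuc v , hv , cong fsuc eq
component-surjective (Lm ∷ w) j with component-surjective w j
... | v , hv , eq = fsuc v , hv , eq
component-surjective (R ∷ w)  j with component-surjective w j
... | v , hv , eq = fsuc v , hv , eq

T-hasComponents : ∀ {m} (w : Vec Letter m) → ProperlyMarked w →
  HasComponents (T w) (suc (#unmarked w))
T-hasComponents w p =
  component w ,
  (λ u v hu hv → mk⇔ (component≡⇒Reach w p u v hu hv) (Reach⇒component≡ w)) ,
  component-surjective w

proposition5p5 :
    (m : ℕ) →
      -- T maps properly marked words of length m = n-1 into subgraphs of P_n containing n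
      ((w : Vec Letter m) → ProperlyMarked w → IsSubgraph (T w) × ContainsLast (T w)) ×
      -- T is injective on properly marked words
      ((w w′ : Vec Letter m) → ProperlyMarked w → ProperlyMarked w′ → T w ≡ T w′ → w ≡ w′) ×
      -- T is surjective onto subgraphs of P_n containing n
      ((G : GraphData m) → IsSubgraph G → ContainsLast G →
         ∃ λ (w : Vec Letter m) → ProperlyMarked w × T w ≡ G) ×
      -- edge count and component count
      ((w : Vec Letter m) → ProperlyMarked w →
         (#marked w ≡ #edges (T w)) × HasComponents (T w) (suc (#unmarked w)))
proposition5p5 m =
  (λ w p → T-isSubgraph w p , T-containsLast w) ,
  (λ w w′ _ _ → T-injective w w′) ,
  (λ G sub last → T⁻¹ G , T⁻¹-properlyMarked G sub , T-T⁻¹ G sub last) ,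
  (λ w p → #marked≡#edges w , T-hasComponents w p)
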